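{- Let $G=(V,E)$ be a graph and let $(m_1,\dots,m_T)$ be any play of the domination game on $G$ (a maximal sequence of legal moves). Then there exists a value function $p$ for this play such that for every $1\le t\le T$, the gain $g(m_t,t)=p(V,t-1)-p(V,t)$ satisfies $g(m_t,t)\ge 3$.
   Context: Domination game: players alternately choose vertices, building $M_0=\emptyset$, $M_t=M_{t-1}\cup\{m_t\}$. $\Gamma[S]$ is the closed neighborhood of $S\subseteq V$, $\Gamma[u]=\Gamma[\{u\}]$. A move $v$ at step $t$ is legal if $\Gamma[M_{t-1}]\subsetneq\Gamma[M_{t-1}\cup\{v\}]$; the game ends at the first $T$ with $\Gamma[M_T]=V$. At the end of step $t$ a vertex $u$ is white ($c_t(u)=W$) if $u\notin\Gamma[M_t]$, blue ($c_t(u)=B$) if $u\in\Gamma[M_t]$ but $\Gamma[u]\not\subseteq\Gamma[M_t]$, and red ($c_t(u)=R$) if $\Gamma[u]\subseteq\Gamma[M_t]$. A value function is a map $p:V\times\{0,\dots,T\}\to\{0,2,3\}$ such that for all $u$ and $t$: $p(u,t)=3$ if $c_t(u)=W$, $p(u,t)=0$ if $c_t(u)=R$, and $p(u,t)\in\{2,3\}$ if $c_t(u)=B$. For $U\subseteq V$, $p(U,t)=\sum_{u\in U}p(u,t)$. -}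

module Defs where

open import Data.Nat using (ℕ; zero; suc; _+_; _≤_; _<_)
open import Data.Fin using (Fin; toℕ)
open import Data.Bool using (Bool; true; false)
open import Data.List using (List; map; allFin)
open import Data.Nat.ListAction using (sum)
open import Data.Product using (Σ; _×_; _,_)
open import Data.Sum using (_⊎_)
open import Relation.Nullary using (¬_)
open import Relation.Binary.PropositionalEquality using (_≡_)

record Graph : Set where
  field
    n      : ℕ
    adj    : Fin n → Fin n → Bool
    sym    : ∀ u v → adj u v ≡ adj v u
    irrefl : ∀ u → adj u u ≡ false

open Graph public

Vtx : Graph → Set
Vtx G = Fin (n G)

InN : (G : Graph) → Vtx G → Vtx G → Set
InN G u v = u ≡ v ⊎ adj G u v ≡ true

-- A sequence of moves m_1..m_T is given as m : Fin T → V, with m i = m_{i+1}.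
-- u ∈ Γ[M_t] where M_t = {m_1,...,m_t}.
Dom : (G : Graph) {T : ℕ} → (Fin T → Vtx G) → ℕ → Vtx G → Set
Dom G {T} m t u = Σ (Fin T) λ i → (toℕ i < t) × InN G (m i) u

White : (G : Graph) {T : ℕ} → (Fin T → Vtx G) → ℕ → Vtx G → Set
White G m t u = ¬ Dom G m t u

Red : (G : Graph) {T : ℕ} → (Fin T → Vtx G) → ℕ → Vtx G → Set
Red G m t u = ∀ w → InN G u w → Dom G m t w

Blue : (G : Graph) {T : ℕ} → (Fin T → Vtx G) → ℕ → Vtx G → Set
Blue G m t u = Dom G m t u × ¬ Red G m t u

-- The move m_{i+1} (index i) is legal: Γ[M_i] ⊊ Γ[M_i ∪ {m_{i+1}}],
-- i.e. some vertex is dominated after step i+1 but not after step i.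
Legal : (G : Graph) {T : ℕ} → (Fin T → Vtx G) → Fin T → Set
Legal G m i = Σ (Vtx G) λ u → Dom G m (suc (toℕ i)) u × ¬ Dom G m (toℕ i) u

-- (m_1,...,m_T) is a play of the domination game: every move legal, and the
-- game ends at T, the first step at which Γ[M_T] = V.
IsPlay : (G : Graph) (T : ℕ) → (Fin T → Vtx G) → Set
IsPlay G T m =
  (∀ i → Legal G m i) ×
  (∀ u → Dom G m T u) ×
  (∀ t → t < T → Σ (Vtx G) λ u → ¬ Dom G m t u)

IsValueFunction : (G : Graph) (T : ℕ) → (Fin T → Vtx G) → (Vtx G → ℕ → ℕ) → Set
IsValueFunction G T m p =
  ∀ u t → t ≤ T →
    (p u t ≡ 0 ⊎ p u t ≡ 2 ⊎ p u t ≡ 3) ×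
    (White G m t u → p u t ≡ 3) ×
    (Red G m t u → p u t ≡ 0) ×
    (Blue G m t u → p u t ≡ 2 ⊎ p u t ≡ 3)

pV : (G : Graph) → (Vtx G → ℕ → ℕ) → ℕ → ℕ
pV G p t = sum (map (λ u → p u t) (allFin (n G)))

module Submission where

-- Take the canonical value function: 3 on white, 2 on blue, 0 on red vertices.
-- Values never increase, since vertices only move from white to blue to red.
-- The move v = m_t always turns red.  If v was white it loses 3.  Otherwise v
-- was blue and loses 2, and by legality some w ≠ v in Γ[v] was white before
-- the move and is dominated after it, so w loses at least 1.

open import Defs hiding (sym)
open import Data.Nat using (ℕ; suc; _+_; _≤_; z≤n; s≤s; _<?_)
open import Data.Nat.Properties
  using (≤-refl; ≤-trans; ≤-reflexive; n≤1+n; m≤m+n; m≤n+m; +-mono-≤; +-monoʳ-≤;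
         +-identityʳ; m≤n⇒m<n∨m≡n; +-commutativeSemigroup; module ≤-Reasoning)
open import Algebra.Properties.CommutativeSemigroup +-commutativeSemigroup using (interchange)
open import Data.Nat.ListAction using (sum)
open import Data.Fin using (Fin; toℕ; _≟_)
open import Data.Fin.Properties using (any?; all?; toℕ-injective)
import Data.Bool.Properties as Bool
open import Data.Bool using (true)
open import Data.List using (List; []; _∷_; map; allFin)
open import Data.List.Relation.Unary.Any using (here; there)
open import Data.List.Membership.Propositional using (_∈_)
open import Data.List.Membership.Propositional.Properties using (∈-allFin)
open import Data.Product using (Σ; _×_; _,_)
open import Data.Sum using (_⊎_; inj₁; inj₂)
open import Data.Empty using (⊥-elim)
open import Relation.Nullary using (¬_; Dec; yes; no)
open import Relation.Nullary.Decidable using (_×-dec_; _⊎-dec_; _→-dec_)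
open import Relation.Binary.PropositionalEquality using (_≡_; refl; sym; cong; module ≡-Reasoning)

sum-map-+ : {A : Set} (f g : A → ℕ) (xs : List A) →
  sum (map (λ x → f x + g x) xs) ≡ sum (map f xs) + sum (map g xs)
sum-map-+ f g [] = refl
sum-map-+ f g (x ∷ xs) = begin
  (f x + g x) + sum (map (λ y → f y + g y) xs)   ≡⟨ cong ((f x + g x) +_) (sum-map-+ f g xs) ⟩
  (f x + g x) + (sum (map f xs) + sum (map g xs)) ≡⟨ interchange (f x) (g x) _ _ ⟩
  (f x + sum (map f xs)) + (g x + sum (map g xs)) ∎
  where open ≡-Reasoning

sum-map-mono : {A : Set} (f g : A → ℕ) (xs : List A) →
  (∀ x → f x ≤ g x) → sum (map f xs) ≤ sum (map g xs)
sum-map-mono f g [] f≤g = z≤n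
sum-map-mono f g (x ∷ xs) f≤g = +-mono-≤ (f≤g x) (sum-map-mono f g xs f≤g)

∈⇒≤sum-map : {A : Set} (f : A → ℕ) {xs : List A} {x : A} → x ∈ xs → f x ≤ sum (map f xs)
∈⇒≤sum-map f {y ∷ xs} (here refl) = m≤m+n (f y) _
∈⇒≤sum-map f {y ∷ xs} (there x∈xs) = ≤-trans (∈⇒≤sum-map f x∈xs) (m≤n+m _ (f y))

_↦_ : {n : ℕ} → Fin n → ℕ → Fin n → ℕ
(v ↦ k) u with u ≟ v
... | yes _ = k
... | no _ = 0

≤sum-↦ : {n : ℕ} (v : Fin n) (k : ℕ) → k ≤ sum (map (v ↦ k) (allFin n))
≤sum-↦ v k with ∈⇒≤sum-map (v ↦ k) (∈-allFin v)
... | le with v ≟ v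
...   | yes _ = le
...   | no v≢v = ⊥-elim (v≢v refl)

weight : {R D : Set} → Dec R → Dec D → ℕ
weight (yes _) _ = 0
weight (no _) (yes _) = 2
weight (no _) (no _) = 3

weight-red : {R D : Set} (R? : Dec R) (D? : Dec D) → R → weight R? D? ≡ 0
weight-red (yes _) D? r = refl
weight-red (no ¬r) D? r = ⊥-elim (¬r r)

weight-blue : {R D : Set} (R? : Dec R) (D? : Dec D) → D → ¬ R → weight R? D? ≡ 2
weight-blue (yes r) D? d ¬r = ⊥-elim (¬r r)
weight-blue (no _) (yes _) d ¬r = refl
weight-blue (no _) (no ¬d) d ¬r = ⊥-elim (¬d d)

weight-white : {R D : Set} (R? : Dec R) (D? : Dec D) → ¬ D → (R → D) → weight R? D? ≡ 3
weight-white (yes r) D? ¬d R⇒D = ⊥-elim (¬d (R⇒D r))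
weight-white (no _) (yes d) ¬d R⇒D = ⊥-elim (¬d d)
weight-white (no _) (no _) ¬d R⇒D = refl

weight-dominated : {R D : Set} (R? : Dec R) (D? : Dec D) → D → weight R? D? ≤ 2
weight-dominated (yes _) D? d = z≤n
weight-dominated (no _) (yes _) d = ≤-refl
weight-dominated (no _) (no ¬d) d = ⊥-elim (¬d d)

weight-valid : {R D : Set} (R? : Dec R) (D? : Dec D) → (R → D) →
  (weight R? D? ≡ 0 ⊎ weight R? D? ≡ 2 ⊎ weight R? D? ≡ 3) ×
  (¬ D → weight R? D? ≡ 3) × (R → weight R? D? ≡ 0) ×
  (D × ¬ R → weight R? D? ≡ 2 ⊎ weight R? D? ≡ 3)
weight-valid R? D? R⇒D =
  weight-values R? D? ,
  (λ ¬d → weight-white R? D? ¬d R⇒D) ,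
  weight-red R? D? ,
  (λ (d , ¬r) → inj₁ (weight-blue R? D? d ¬r))
  where
  weight-values : {R D : Set} (R? : Dec R) (D? : Dec D) →
    weight R? D? ≡ 0 ⊎ weight R? D? ≡ 2 ⊎ weight R? D? ≡ 3
  weight-values (yes _) _ = inj₁ refl
  weight-values (no _) (yes _) = inj₂ (inj₁ refl)
  weight-values (no _) (no _) = inj₂ (inj₂ refl)

weight-antitone : {R D R′ D′ : Set} (R? : Dec R) (D? : Dec D) (R′? : Dec R′) (D′? : Dec D′) →
  (R → R′) → (D → D′) → weight R′? D′? ≤ weight R? D?
weight-antitone R? D? (yes _) D′? R⇒R′ D⇒D′ = z≤n
weight-antitone (yes r) D? (no ¬r′) D′? R⇒R′ D⇒D′ = ⊥-elim (¬r′ (R⇒R′ r))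
weight-antitone (no _) (yes d) (no _) (no ¬d′) R⇒R′ D⇒D′ = ⊥-elim (¬d′ (D⇒D′ d))
weight-antitone (no _) (yes _) (no _) (yes _) R⇒R′ D⇒D′ = ≤-refl
weight-antitone (no _) (no _) (no _) (yes _) R⇒R′ D⇒D′ = s≤s (s≤s z≤n)
weight-antitone (no _) (no _) (no _) (no _) R⇒R′ D⇒D′ = ≤-refl

module Play (G : Graph) {T : ℕ} (m : Fin T → Vtx G) where

  InN? : ∀ u v → Dec (InN G u v)
  InN? u v = (u ≟ v) ⊎-dec (adj G u v Bool.≟ true)

  Dom? : ∀ t u → Dec (Dom G m t u)
  Dom? t u = any? (λ i → (toℕ i <? t) ×-dec InN? (m i) u)

  Red? : ∀ t u → Dec (Red G m t u)
  Red? t u = all? (λ w → InN? u w →-dec Dom? t w)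

  Red⇒Dom : ∀ {t u} → Red G m t u → Dom G m t u
  Red⇒Dom red = red _ (inj₁ refl)

  Dom-suc : ∀ {t u} → Dom G m t u → Dom G m (suc t) u
  Dom-suc (i , i<t , i∼u) = i , ≤-trans i<t (n≤1+n _) , i∼u

  Red-suc : ∀ {t u} → Red G m t u → Red G m (suc t) u
  Red-suc red w u∼w = Dom-suc (red w u∼w)

  Red-move : ∀ i → Red G m (suc (toℕ i)) (m i)
  Red-move i w i∼w = i , ≤-refl , i∼w

  Legal⇒newly-dominated-neighbour : ∀ i → Legal G m i →
    Σ (Vtx G) λ w → InN G (m i) w × ¬ Dom G m (toℕ i) w
  Legal⇒newly-dominated-neighbour i (w , (j , s≤s j≤i , j∼w) , ¬dom) with j ≟ i
  ... | yes refl = w , j∼w , ¬dom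
  ... | no j≢i with m≤n⇒m<n∨m≡n j≤i
  ...   | inj₁ j<i = ⊥-elim (¬dom (j , j<i , j∼w))
  ...   | inj₂ j≡i = ⊥-elim (j≢i (toℕ-injective j≡i))

  value : Vtx G → ℕ → ℕ
  value u t = weight (Red? t u) (Dom? t u)

  value-isValueFunction : IsValueFunction G T m value
  value-isValueFunction u t _ = weight-valid (Red? t u) (Dom? t u) Red⇒Dom

  value-antitone : ∀ t u → value u (suc t) ≤ value u t
  value-antitone t u = weight-antitone (Red? t u) (Dom? t u) (Red? (suc t) u) (Dom? (suc t) u) Red-suc Dom-suc

  value-move : ∀ i → value (m i) (suc (toℕ i)) ≡ 0
  value-move i = weight-red (Red? (suc (toℕ i)) (m i)) (Dom? (suc (toℕ i)) (m i)) (Red-move i)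

  gain-from-drops : ∀ t k (b : Vtx G → ℕ) → k ≤ sum (map b (allFin (n G))) →
    (∀ u → value u (suc t) + b u ≤ value u t) →
    pV G value (suc t) + k ≤ pV G value t
  gain-from-drops t k b k≤Σb drops = begin
    sum (map (λ u → value u (suc t)) Vs) + k
      ≤⟨ +-monoʳ-≤ _ k≤Σb ⟩
    sum (map (λ u → value u (suc t)) Vs) + sum (map b Vs)
      ≡⟨ sym (sum-map-+ (λ u → value u (suc t)) b Vs) ⟩
    sum (map (λ u → value u (suc t) + b u) Vs)
      ≤⟨ sum-map-mono _ _ Vs drops ⟩
    sum (map (λ u → value u t) Vs) ∎
    where
    open ≤-Reasoning
    Vs = allFin (n G)

  value-antitone+0 : ∀ t u → value u (suc t) + 0 ≤ value u t
  value-antitone+0 t u = ≤-trans (≤-reflexive (+-identityʳ _)) (value-antitone t u)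

  white-move-drops : ∀ i → ¬ Dom G m (toℕ i) (m i) →
    ∀ u → value u (suc (toℕ i)) + (m i ↦ 3) u ≤ value u (toℕ i)
  white-move-drops i ¬dom u with u ≟ m i
  ... | no _ = value-antitone+0 (toℕ i) u
  ... | yes refl rewrite value-move i
                       | weight-white (Red? (toℕ i) u) (Dom? (toℕ i) u) ¬dom Red⇒Dom = ≤-refl

  blue-move-drops : ∀ i → Dom G m (toℕ i) (m i) →
    (w : Vtx G) → InN G (m i) w → ¬ Dom G m (toℕ i) w →
    ∀ u → value u (suc (toℕ i)) + ((m i ↦ 2) u + (w ↦ 1) u) ≤ value u (toℕ i)
  blue-move-drops i dom w i∼w ¬dom-w u with u ≟ m i | u ≟ w
  ... | yes refl | yes refl = ⊥-elim (¬dom-w dom)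
  ... | yes refl | no _ rewrite value-move i
                              | weight-blue (Red? (toℕ i) u) (Dom? (toℕ i) u) dom (λ red → ¬dom-w (red w i∼w))
                              = ≤-refl
  ... | no _ | yes refl rewrite weight-white (Red? (toℕ i) u) (Dom? (toℕ i) u) ¬dom-w Red⇒Dom =
    +-mono-≤ (weight-dominated (Red? (suc (toℕ i)) u) (Dom? (suc (toℕ i)) u) (i , ≤-refl , i∼w)) (≤-refl {1})
  ... | no _ | no _ = value-antitone+0 (toℕ i) u

  move-gain : ∀ i → Legal G m i → pV G value (suc (toℕ i)) + 3 ≤ pV G value (toℕ i)
  move-gain i legal with Dom? (toℕ i) (m i)
  ... | no ¬dom = gain-from-drops (toℕ i) 3 (m i ↦ 3) (≤sum-↦ (m i) 3) (white-move-drops i ¬dom)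
  ... | yes dom with Legal⇒newly-dominated-neighbour i legal
  ...   | w , i∼w , ¬dom-w = gain-from-drops (toℕ i) 3 b 3≤Σb (blue-move-drops i dom w i∼w ¬dom-w)
    where
    b : Vtx G → ℕ
    b u = (m i ↦ 2) u + (w ↦ 1) u
    3≤Σb : 3 ≤ sum (map b (allFin (n G)))
    3≤Σb = ≤-trans (+-mono-≤ (≤sum-↦ (m i) 2) (≤sum-↦ w 1))
                   (≤-reflexive (sym (sum-map-+ (m i ↦ 2) (w ↦ 1) (allFin (n G)))))

corollary1 : (G : Graph) (T : ℕ) (m : Fin T → Vtx G) → IsPlay G T m →
    Σ (Vtx G → ℕ → ℕ) λ p → IsValueFunction G T m p ×
      (∀ (i : Fin T) → pV G p (suc (toℕ i)) + 3 ≤ pV G p (toℕ i))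
corollary1 G T m (legal , _ , _) =
  value , value-isValueFunction , λ i → move-gain i (legal i)
  where open Play G m
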